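{- For any set $\Gamma\cup\{\phi\}$ of formulas in the language of $\mathbf{CPL}^+$: if $\Gamma\vdash\phi$ in the natural deduction system of $\mathbf{CPL}^+$, then $\Gamma\models\phi$.
   Context: Formulas of $\mathbf{CPL}^+$: $\phi::=p_i\mid\neg p_i\mid\bot\mid\mathrm{NE}\mid\phi\wedge\phi\mid\phi\otimes\phi$. A valuation on $N\subseteq\mathbb N$ is $s:N\to\{0,1\}$, a team on $N$ a set of such (a team: on $\mathbb N$). Semantics: $X\models p_i$ iff $s(i)=1$ for all $s\in X$; $X\models\neg p_i$ iff $s(i)=0$ for all $s\in X$; $X\models\bot$ iff $X=\emptyset$; $X\models\mathrm{NE}$ iff $X\neq\emptyset$; $\wedge$ as usual; $X\models\phi\otimes\psi$ iff $X=Y\cup Z$ for some $Y,Z\subseteq X$ with $Y\models\phi$, $Z\models\psi$. $\Gamma\models\phi$: every team satisfying all of $\Gamma$ satisfies $\phi$. Classical formulas: those without $\mathrm{NE}$. $p_i^1=p_i$, $p_i^0=\neg p_i$; empty $\otimes$-disjunction is $\bot$; for a team $X$ on finite $N=\{i_1,\dots,i_n\}$, $\Theta^*_X=\bigotimes_{s\in X}(p_{i_1}^{s(i_1)}\wedge\dots\wedge p_{i_n}^{s(i_n)}\wedge\mathrm{NE})$. A formula is viewed as a string of symbols numbered from the left starting at 1; $[\psi,m]$ denotes the occurrence of the subformula $\psi$ beginning at the $m$-th symbol, and $\phi(\beta/[\psi,m])$ the result of replacing that occurrence by $\beta$. Natural deduction system of $\mathbf{CPL}^+$ ($\Gamma\vdash\phi$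 iff some derivation of $\phi$ has undischarged assumptions in $\Gamma$; metavariables range over all formulas, axioms are specific formulas, no substitution rule). Axiom: $p_i\otimes\neg p_i$ (each $i$). Rules: standard $\wedge$-introduction/elimination; from $\phi$ infer $\phi\otimes\psi$ if $\psi$ does not contain $\mathrm{NE}$; from $\phi$ infer $\phi\otimes\phi$; from $\phi\otimes\psi$, a derivation of $\alpha$ from $\phi$ and one from $\psi$, infer $\alpha$ (discharging $\phi,\psi$), provided $\alpha$ is classical and the other undischarged assumptions of both subderivations are classical; from $\phi\otimes\psi$ and a derivation of $\chi$ from $\psi$ (discharged) infer $\phi\otimes\chi$, provided the other undischarged assumptions of that subderivation are classical; from $\phi\otimes\psi$ infer $\psi\otimes\phi$; from $\phi\otimes(\psi\otimes\chi)$ infer $(\phi\otimes\psi)\otimes\chi$; from $p_i\wedge\neg p_i$ infer $\bot$; from $\phi\otimes\bot$ infer $\phi$; from $\bot\wedge\mathrm{NE}$ infer any $\phi$; from $\phi\otimes(\bot\wedge\mathrm{NE})$ infer $\bot\wedge\mathrm{NE}$; from $\Theta^*_X\wedge\Theta^*_Y$ infer $\bot\wedge\mathrm{NE}$ for distinct teams $X,Y$ on the same finite index set; from $\alpha\wedge(\psi\otimes\chi)$ infer $(\alpha\wedge\psi)\otimes(\alpha\wedge\chi)$ for classical $\alpha$; Strong elimination 1: given a finite index set $N$ with $Y_1,\dots,Y_k$ all nonempty teams on $N$, and an occurrence $[\mathrm{NE},m]$ in $\phi$: from $\phi$ and derivations of $\theta$ from each $\phi(\Theta^*_{Y_j}/[\mathrm{NE},m])$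 (discharged), infer $\theta$; Strong elimination 2: for an occurrence $[\psi,m]$ of a subformula of $\phi$: from $\phi$, a derivation of $\theta$ from $\phi(\psi\wedge\bot/[\psi,m])$ and one from $\phi(\psi\wedge\mathrm{NE}/[\psi,m])$ (discharged), infer $\theta$. -}

module Defs where

open import Level using (0ℓ)
open import Data.Nat using (ℕ)
open import Data.Bool using (Bool; true; false)
open import Data.List using (List; []; _∷_; length)
open import Data.Vec using (Vec; []; _∷_)
open import Data.Product using (Σ; ∃; _×_; _,_)
open import Data.Sum using (_⊎_)
open import Data.Unit using (⊤)
open import Data.Empty renaming (⊥ to Empty)
open import Relation.Nullary using (¬_)
open import Relation.Binary.PropositionalEquality using (_≡_)
open import Data.List.Relation.Unary.Unique.Propositional using (Unique)
open import Data.List.Membership.Propositional using (_∈_)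
open import Function.Bundles using (_⇔_)

infixr 6 _∧_
infixr 5 _⊗_

data Form : Set where
  p   : ℕ → Form
  ¬p  : ℕ → Form
  ⊥   : Form
  NE  : Form
  _∧_ : Form → Form → Form
  _⊗_ : Form → Form → Form

Classical : Form → Set
Classical (p i)   = ⊤
Classical (¬p i)  = ⊤
Classical ⊥       = ⊤
Classical NE      = Empty
Classical (φ ∧ ψ) = Classical φ × Classical ψ
Classical (φ ⊗ ψ) = Classical φ × Classical ψ

lit : ℕ → Bool → Form
lit i true  = p i
lit i false = ¬p i

-- Occurrences of subformulas (positions in the syntax tree; these are in
-- one-to-one correspondence with the occurrences [ψ,m] in the string).

data Occ : Form → Set where
  here : ∀ {φ} → Occ φ
  ∧ₗ   : ∀ {φ ψ} → Occ φ → Occ (φ ∧ ψ)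
  ∧ᵣ   : ∀ {φ ψ} → Occ ψ → Occ (φ ∧ ψ)
  ⊗ₗ   : ∀ {φ ψ} → Occ φ → Occ (φ ⊗ ψ)
  ⊗ᵣ   : ∀ {φ ψ} → Occ ψ → Occ (φ ⊗ ψ)

subAt : (φ : Form) → Occ φ → Form
subAt φ       here   = φ
subAt (φ ∧ ψ) (∧ₗ o) = subAt φ o
subAt (φ ∧ ψ) (∧ᵣ o) = subAt ψ o
subAt (φ ⊗ ψ) (⊗ₗ o) = subAt φ o
subAt (φ ⊗ ψ) (⊗ᵣ o) = subAt ψ o

replaceAt : (φ : Form) → Occ φ → Form → Form
replaceAt φ       here   β = β
replaceAt (φ ∧ ψ) (∧ₗ o) β = replaceAt φ o β ∧ ψ
replaceAt (φ ∧ ψ) (∧ᵣ o) β = φ ∧ replaceAt ψ o β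
replaceAt (φ ⊗ ψ) (⊗ₗ o) β = replaceAt φ o β ⊗ ψ
replaceAt (φ ⊗ ψ) (⊗ᵣ o) β = φ ⊗ replaceAt ψ o β

-- N is given as a list of distinct indices [i₁,…,iₙ]; a valuation on N is a
-- Vec Bool n (s(iₖ) is the k-th entry); a team X on N is given by an
-- enumeration (a duplicate-free list) of its valuations.

conjOf : (N : List ℕ) → Vec Bool (length N) → Form
conjOf []      []      = NE
conjOf (i ∷ N) (b ∷ v) = lit i b ∧ conjOf N v

⨂ : List Form → Form
⨂ []           = ⊥
⨂ (φ ∷ [])     = φ
⨂ (φ ∷ ψ ∷ φs) = φ ⊗ ⨂ (ψ ∷ φs)

mapConj : (N : List ℕ) → List (Vec Bool (length N)) → List Form
mapConj N []       = []
mapConj N (v ∷ vs) = conjOf N v ∷ mapConj N vs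

Θ* : (N : List ℕ) → List (Vec Bool (length N)) → Form
Θ* N X = ⨂ (mapConj N X)

TeamOn : (N : List ℕ) → List (Vec Bool (length N)) → Set
TeamOn N X = Unique X

SameTeam : ∀ {A : Set} → List A → List A → Set
SameTeam X Y = ∀ v → (v ∈ X) ⇔ (v ∈ Y)

Ctx : Set₁
Ctx = Form → Set

_,,_ : Ctx → Form → Ctx
(Γ ,, φ) ψ = Γ ψ ⊎ ψ ≡ φ

_⊆ᶜ_ : Ctx → Ctx → Set
Δ ⊆ᶜ Γ = ∀ ψ → Δ ψ → Γ ψ

AllClassical : Ctx → Set
AllClassical Δ = ∀ ψ → Δ ψ → Classical ψ

infix 2 _⊢_

-- Side conditions "the other undischarged assumptions are classical" are
-- expressed by a classical sub-context Δ ⊆ Γ of the subderivations.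
data _⊢_ (Γ : Ctx) : Form → Set₁ where
  assm  : ∀ {φ} → Γ φ → Γ ⊢ φ
  EM    : ∀ i → Γ ⊢ p i ⊗ ¬p i
  ∧I    : ∀ {φ ψ} → Γ ⊢ φ → Γ ⊢ ψ → Γ ⊢ φ ∧ ψ
  ∧E₁   : ∀ {φ ψ} → Γ ⊢ φ ∧ ψ → Γ ⊢ φ
  ∧E₂   : ∀ {φ ψ} → Γ ⊢ φ ∧ ψ → Γ ⊢ ψ
  ⊗I    : ∀ {φ ψ} → Classical ψ → Γ ⊢ φ → Γ ⊢ φ ⊗ ψ
  ⊗Dup  : ∀ {φ} → Γ ⊢ φ → Γ ⊢ φ ⊗ φ
  ⊗E    : ∀ {φ ψ α} (Δ : Ctx) → Δ ⊆ᶜ Γ → AllClassical Δ → Classical α →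
          Γ ⊢ φ ⊗ ψ → (Δ ,, φ) ⊢ α → (Δ ,, ψ) ⊢ α → Γ ⊢ α
  ⊗Sub  : ∀ {φ ψ χ} (Δ : Ctx) → Δ ⊆ᶜ Γ → AllClassical Δ →
          Γ ⊢ φ ⊗ ψ → (Δ ,, ψ) ⊢ χ → Γ ⊢ φ ⊗ χ
  ⊗Comm : ∀ {φ ψ} → Γ ⊢ φ ⊗ ψ → Γ ⊢ ψ ⊗ φ
  ⊗Ass  : ∀ {φ ψ χ} → Γ ⊢ φ ⊗ (ψ ⊗ χ) → Γ ⊢ (φ ⊗ ψ) ⊗ χ
  Contr : ∀ {i} → Γ ⊢ p i ∧ ¬p i → Γ ⊢ ⊥
  ⊗⊥E   : ∀ {φ} → Γ ⊢ φ ⊗ ⊥ → Γ ⊢ φ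
  ⊥NE-E : ∀ {φ} → Γ ⊢ ⊥ ∧ NE → Γ ⊢ φ
  ⊗⊥NE  : ∀ {φ} → Γ ⊢ φ ⊗ (⊥ ∧ NE) → Γ ⊢ ⊥ ∧ NE
  ΘDist : (N : List ℕ) → Unique N → (X Y : List (Vec Bool (length N))) →
          TeamOn N X → TeamOn N Y → ¬ SameTeam X Y →
          Γ ⊢ Θ* N X ∧ Θ* N Y → Γ ⊢ ⊥ ∧ NE
  Distr : ∀ {α ψ χ} → Classical α → Γ ⊢ α ∧ (ψ ⊗ χ) → Γ ⊢ (α ∧ ψ) ⊗ (α ∧ χ)
  -- Strong elimination 1: for every nonempty team Y on N (given as a subset
  -- of Bool^N) a derivation of θ from φ(Θ*_Y / o), Θ*_Y built from an
  -- enumeration of Y.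
  SE1   : ∀ {φ θ} (N : List ℕ) → Unique N → (o : Occ φ) → subAt φ o ≡ NE →
          Γ ⊢ φ →
          ((Y : Vec Bool (length N) → Bool) → (∃ λ v → Y v ≡ true) →
            Σ (List (Vec Bool (length N))) λ ys →
              TeamOn N ys × (∀ v → (v ∈ ys) ⇔ (Y v ≡ true)) ×
              ((Γ ,, replaceAt φ o (Θ* N ys)) ⊢ θ)) →
          Γ ⊢ θ
  SE2   : ∀ {φ θ} (o : Occ φ) → Γ ⊢ φ →
          (Γ ,, replaceAt φ o (subAt φ o ∧ ⊥)) ⊢ θ →
          (Γ ,, replaceAt φ o (subAt φ o ∧ NE)) ⊢ θ →
          Γ ⊢ θ

Valuation : Set
Valuation = ℕ → Bool

Team : Set₁
Team = Valuation → Set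

_⊆ₜ_ : Team → Team → Set
Y ⊆ₜ X = ∀ s → Y s → X s

infix 3 _⊨_

_⊨_ : Team → Form → Set₁
X ⊨ p i    = Level.Lift _ (∀ s → X s → s i ≡ true)
X ⊨ ¬p i   = Level.Lift _ (∀ s → X s → s i ≡ false)
X ⊨ ⊥      = Level.Lift _ (∀ s → ¬ X s)
X ⊨ NE     = Level.Lift _ (∃ λ s → X s)
X ⊨ φ ∧ ψ  = (X ⊨ φ) × (X ⊨ ψ)
X ⊨ φ ⊗ ψ  = Σ Team λ Y → Σ Team λ Z →
               Y ⊆ₜ X × Z ⊆ₜ X × (∀ s → X s → Y s ⊎ Z s) ×
               (Y ⊨ φ) × (Z ⊨ ψ)

_⊨ᶜ_ : Ctx → Form → Set₁
Γ ⊨ᶜ φ = (X : Team) → (∀ ψ → Γ ψ → X ⊨ ψ) → X ⊨ φ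

module Submission where

-- The proof is the usual induction on derivations, each rule being matched
-- by a semantic fact about teams.  With excluded middle (deciding whether W is empty,
--     and which valuations its members restrict to) this yields the two
--     strong elimination rules.

open import Defs
open import Level using (0ℓ; lift)
open import Axiom.ExcludedMiddle using (ExcludedMiddle)
open import Data.Nat using (ℕ)
open import Data.Bool using (Bool; true; false)
open import Data.List using (List; []; _∷_; length)
open import Data.List.Membership.Propositional using (_∈_)
open import Data.List.Relation.Unary.Any using (here; there)
open import Data.Vec using (Vec; []; _∷_)
open import Data.Vec.Properties using (∷-injectiveˡ; ∷-injectiveʳ)
open import Data.Product using (Σ; ∃; _×_; _,_; proj₁; proj₂)
open import Data.Sum using (_⊎_; inj₁; inj₂; [_,_])
import Data.Sum as Sum
open import Data.Empty using (⊥-elim)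
open import Relation.Nullary using (¬_; Dec; yes; no; does)
open import Relation.Nullary.Decidable using (dec-true)
open import Relation.Unary using (Satisfiable; _∩_; _∪_; ∅)
open import Relation.Binary.PropositionalEquality using (_≡_; refl; sym; trans; cong₂; subst)
open import Function.Bundles using (_⇔_; mk⇔; Equivalence)

_⊨ᵃ_ : Team → Ctx → Set₁
X ⊨ᵃ Γ = ∀ ψ → Γ ψ → X ⊨ ψ

⊆-refl : ∀ {X : Team} → X ⊆ₜ X
⊆-refl s x = x

⊨-ext : ∀ φ {X Y : Team} → X ⊆ₜ Y → Y ⊆ₜ X → Y ⊨ φ → X ⊨ φ
⊨-ext (p i)   X⊆Y Y⊆X (lift a) = lift λ s x → a s (X⊆Y s x)
⊨-ext (¬p i)  X⊆Y Y⊆X (lift a) = lift λ s x → a s (X⊆Y s x)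
⊨-ext ⊥       X⊆Y Y⊆X (lift a) = lift λ s x → a s (X⊆Y s x)
⊨-ext NE      X⊆Y Y⊆X (lift (s , y)) = lift (s , Y⊆X s y)
⊨-ext (φ ∧ ψ) X⊆Y Y⊆X (a , b) = ⊨-ext φ X⊆Y Y⊆X a , ⊨-ext ψ X⊆Y Y⊆X b
⊨-ext (φ ⊗ ψ) X⊆Y Y⊆X (Y₁ , Y₂ , Y₁⊆Y , Y₂⊆Y , cover , a , b) =
  Y₁ , Y₂ , (λ s y → Y⊆X s (Y₁⊆Y s y)) , (λ s y → Y⊆X s (Y₂⊆Y s y)) ,
  (λ s x → cover s (X⊆Y s x)) , a , b

classical-empty : ∀ φ → Classical φ → ∅ ⊨ φ
classical-empty (p i)   _       = lift λ s ()
classical-empty (¬p i)  _       = lift λ s ()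
classical-empty ⊥       _       = lift λ s ()
classical-empty (φ ∧ ψ) (c , d) = classical-empty φ c , classical-empty ψ d
classical-empty (φ ⊗ ψ) (c , d) =
  ∅ , ∅ , ⊆-refl , ⊆-refl , (λ s ()) , classical-empty φ c , classical-empty ψ d

classical-downward : ∀ φ → Classical φ → ∀ {X Y : Team} → Y ⊆ₜ X → X ⊨ φ → Y ⊨ φ
classical-downward (p i)   _       Y⊆X (lift a) = lift λ s y → a s (Y⊆X s y)
classical-downward (¬p i)  _       Y⊆X (lift a) = lift λ s y → a s (Y⊆X s y)
classical-downward ⊥       _       Y⊆X (lift a) = lift λ s y → a s (Y⊆X s y)
classical-downward (φ ∧ ψ) (c , d) Y⊆X (a , b) =
  classical-downward φ c Y⊆X a , classical-downward ψ d Y⊆X b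
classical-downward (φ ⊗ ψ) (c , d) {Y = Y} Y⊆X (X₁ , X₂ , _ , _ , cover , a , b) =
  Y ∩ X₁ , Y ∩ X₂ , (λ s → proj₁) , (λ s → proj₁) ,
  (λ s y → Sum.map (y ,_) (y ,_) (cover s (Y⊆X s y))) ,
  classical-downward φ c (λ s → proj₂) a , classical-downward ψ d (λ s → proj₂) b

classical-union : ∀ φ → Classical φ → ∀ {X Y Z : Team} →
  (∀ s → X s → Y s ⊎ Z s) → Y ⊨ φ → Z ⊨ φ → X ⊨ φ
classical-union (p i)   _ cover (lift a) (lift b) = lift λ s x → [ a s , b s ] (cover s x)
classical-union (¬p i)  _ cover (lift a) (lift b) = lift λ s x → [ a s , b s ] (cover s x)
classical-union ⊥       _ cover (lift a) (lift b) = lift λ s x → [ a s , b s ] (cover s x)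
classical-union (φ ∧ ψ) (c , d) cover (a₁ , a₂) (b₁ , b₂) =
  classical-union φ c cover a₁ b₁ , classical-union ψ d cover a₂ b₂
classical-union (φ ⊗ ψ) (c , d) {X} cover
  (Y₁ , Y₂ , _ , _ , coverY , a₁ , a₂) (Z₁ , Z₂ , _ , _ , coverZ , b₁ , b₂) =
  X ∩ (Y₁ ∪ Z₁) , X ∩ (Y₂ ∪ Z₂) , (λ s → proj₁) , (λ s → proj₁) , cover′ ,
  classical-union φ c (λ s → proj₂) a₁ b₁ , classical-union ψ d (λ s → proj₂) a₂ b₂
  where
  cover′ : ∀ s → X s → (X ∩ (Y₁ ∪ Z₁)) s ⊎ (X ∩ (Y₂ ∪ Z₂)) s
  cover′ s x = [ (λ y → Sum.map (λ y₁ → x , inj₁ y₁) (λ y₂ → x , inj₁ y₂) (coverY s y))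
               , (λ z → Sum.map (λ z₁ → x , inj₂ z₁) (λ z₂ → x , inj₂ z₂) (coverZ s z))
               ] (cover s x)

-- The assumptions Δ ⊆ Γ that are classical survive passing to a subteam;
-- this is the semantic content of the side conditions of ⊗E and ⊗Sub.
classical-ctx-downward : ∀ {Γ Δ : Ctx} {X Y : Team} → Δ ⊆ᶜ Γ → AllClassical Δ →
  Y ⊆ₜ X → X ⊨ᵃ Γ → Y ⊨ᵃ Δ
classical-ctx-downward Δ⊆Γ cl Y⊆X h ψ δ = classical-downward ψ (cl ψ δ) Y⊆X (h ψ (Δ⊆Γ ψ δ))

⊨ᵃ-extend : ∀ {Γ : Ctx} {X : Team} {φ} → X ⊨ᵃ Γ → X ⊨ φ → X ⊨ᵃ (Γ ,, φ)
⊨ᵃ-extend h a ψ (inj₁ γ)    = h ψ γ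
⊨ᵃ-extend h a ψ (inj₂ refl) = a

⊥∧NE-unsat : ∀ {X : Team} → ¬ (X ⊨ ⊥ ∧ NE)
⊥∧NE-unsat (lift empty , lift (s , x)) = empty s x

⊨-EM : ∀ {X : Team} i → X ⊨ p i ⊗ ¬p i
⊨-EM {X} i =
  X ∩ (λ s → s i ≡ true) , X ∩ (λ s → s i ≡ false) , (λ s → proj₁) , (λ s → proj₁) ,
  (λ s x → Sum.map (x ,_) (x ,_) (true-or-false (s i))) , lift (λ s → proj₂) , lift (λ s → proj₂)
  where
  true-or-false : (b : Bool) → b ≡ true ⊎ b ≡ false
  true-or-false true  = inj₁ refl
  true-or-false false = inj₂ refl

⊨-⊗-assoc : ∀ {X : Team} {φ ψ χ} → X ⊨ φ ⊗ (ψ ⊗ χ) → X ⊨ (φ ⊗ ψ) ⊗ χ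
⊨-⊗-assoc {X} (Y , Z , Y⊆X , Z⊆X , cover , y , (Z₁ , Z₂ , Z₁⊆Z , Z₂⊆Z , coverZ , z₁ , z₂)) =
  Y ∪ Z₁ , Z₂ , (λ s → [ Y⊆X s , (λ z → Z⊆X s (Z₁⊆Z s z)) ]) , (λ s z → Z⊆X s (Z₂⊆Z s z)) ,
  cover′ , (Y , Z₁ , (λ s → inj₁) , (λ s → inj₂) , (λ s q → q) , y , z₁) , z₂
  where
  cover′ : ∀ s → X s → (Y ∪ Z₁) s ⊎ Z₂ s
  cover′ s x = [ (λ y → inj₁ (inj₁ y)) , (λ z → Sum.map inj₂ (λ z₂ → z₂) (coverZ s z)) ] (cover s x)

⊨-⊗⊥-elim : ∀ {X : Team} φ → X ⊨ φ ⊗ ⊥ → X ⊨ φ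
⊨-⊗⊥-elim φ (Y , Z , Y⊆X , _ , cover , y , lift Z-empty) =
  ⊨-ext φ (λ s x → [ (λ y → y) , (λ z → ⊥-elim (Z-empty s z)) ] (cover s x)) Y⊆X y

-- Θ* describes a team up to restriction to N.

restrict : (N : List ℕ) → Valuation → Vec Bool (length N)
restrict []      s = []
restrict (i ∷ N) s = s i ∷ restrict N s

Image : (N : List ℕ) → Team → Vec Bool (length N) → Set
Image N W v = ∃ λ s → W s × restrict N s ≡ v

Realises : (N : List ℕ) → Team → List (Vec Bool (length N)) → Set
Realises N W vs = (∀ s → W s → restrict N s ∈ vs) × (∀ v → v ∈ vs → Image N W v)

lit-sound : ∀ i b {W : Team} → W ⊨ lit i b → ∀ s → W s → s i ≡ b
lit-sound i true  (lift h) = h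
lit-sound i false (lift h) = h

lit-complete : ∀ i b {W : Team} → (∀ s → W s → s i ≡ b) → W ⊨ lit i b
lit-complete i true  h = lift h
lit-complete i false h = lift h

conjOf-sound : ∀ N v {W : Team} → W ⊨ conjOf N v →
  (∀ s → W s → restrict N s ≡ v) × Satisfiable W
conjOf-sound []      []      (lift ne) = (λ s x → refl) , ne
conjOf-sound (i ∷ N) (b ∷ v) (a , r) =
  (λ s x → cong₂ _∷_ (lit-sound i b a s x) (proj₁ (conjOf-sound N v r) s x)) ,
  proj₂ (conjOf-sound N v r)

conjOf-complete : ∀ N v {W : Team} → (∀ s → W s → restrict N s ≡ v) → Satisfiable W →
  W ⊨ conjOf N v
conjOf-complete []      []      h ne = lift ne
conjOf-complete (i ∷ N) (b ∷ v) h ne =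
  lit-complete i b (λ s x → ∷-injectiveˡ (h s x)) ,
  conjOf-complete N v (λ s x → ∷-injectiveʳ (h s x)) ne

Θ*-sound : ∀ N vs {W : Team} → W ⊨ Θ* N vs → Realises N W vs
Θ*-sound N [] (lift empty) = (λ s x → ⊥-elim (empty s x)) , (λ v ())
Θ*-sound N (v ∷ []) h with conjOf-sound N v h
... | all-v , (s₀ , x₀) = (λ s x → here (all-v s x)) , λ { w (here refl) → s₀ , x₀ , all-v s₀ x₀ }
Θ*-sound N (v ∷ w ∷ vs) {W} (Y , Z , Y⊆W , Z⊆W , cover , a , b)
  with conjOf-sound N v a | Θ*-sound N (w ∷ vs) b
... | all-v , (s₀ , y₀) | inZ , imageZ = inW , imageW
  where
  inW : ∀ s → W s → restrict N s ∈ v ∷ w ∷ vs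
  inW s x = [ (λ y → here (all-v s y)) , (λ z → there (inZ s z)) ] (cover s x)
  imageW : ∀ u → u ∈ v ∷ w ∷ vs → Image N W u
  imageW u (here refl) = s₀ , Y⊆W s₀ y₀ , all-v s₀ y₀
  imageW u (there u∈) with imageZ u u∈
  ... | s , z , eq = s , Z⊆W s z , eq

-- For a nonempty list the team is split according to the first entry.
Θ*-complete-cons : ∀ N v vs {W : Team} → Realises N W (v ∷ vs) → W ⊨ Θ* N (v ∷ vs)
Θ*-complete-cons N v [] (inW , imageW) with imageW v (here refl)
... | s₀ , x₀ , _ = conjOf-complete N v (λ s x → only (inW s x)) (s₀ , x₀)
  where
  only : ∀ {u} → u ∈ v ∷ [] → u ≡ v
  only (here eq) = eq
Θ*-complete-cons N v (w ∷ vs) {W} (inW , imageW) with imageW v (here refl)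
... | s₀ , x₀ , eq₀ =
  W ∩ (λ s → restrict N s ≡ v) , W ∩ (λ s → restrict N s ∈ w ∷ vs) ,
  (λ s → proj₁) , (λ s → proj₁) , cover ,
  conjOf-complete N v (λ s → proj₂) (s₀ , x₀ , eq₀) ,
  Θ*-complete-cons N w vs ((λ s → proj₂) , imageRest)
  where
  cover : ∀ s → W s → (W s × restrict N s ≡ v) ⊎ (W s × restrict N s ∈ w ∷ vs)
  cover s x with inW s x
  ... | here eq  = inj₁ (x , eq)
  ... | there u∈ = inj₂ (x , u∈)
  imageRest : ∀ u → u ∈ w ∷ vs → Image N (W ∩ (λ s → restrict N s ∈ w ∷ vs)) u
  imageRest u u∈ with imageW u (there u∈)
  ... | s , x , refl = s , (x , u∈) , refl

Θ*-complete : ∀ N vs {W : Team} → Satisfiable W → Realises N W vs → W ⊨ Θ* N vs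
Θ*-complete N []       (s₀ , x₀) (inW , _) with inW s₀ x₀
... | ()
Θ*-complete N (v ∷ vs) _         realises = Θ*-complete-cons N v vs realises

Θ*-determines-team : ∀ N xs ys {W : Team} → W ⊨ Θ* N xs → W ⊨ Θ* N ys → SameTeam xs ys
Θ*-determines-team N xs ys a b v = mk⇔ (transfer (Θ*-sound N xs a) (Θ*-sound N ys b))
                                       (transfer (Θ*-sound N ys b) (Θ*-sound N xs a))
  where
  transfer : ∀ {W us ws} → Realises N W us → Realises N W ws → v ∈ us → v ∈ ws
  transfer (_ , imageU) (inW , _) v∈ with imageU v v∈
  ... | s , x , refl = inW s x

locate : ∀ φ (o : Occ φ) {X : Team} → X ⊨ φ →
  Σ Team λ W → (W ⊨ subAt φ o) × (∀ β → W ⊨ β → X ⊨ replaceAt φ o β)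
locate φ here {X} h = X , h , λ β b → b
locate (φ ∧ ψ) (∧ₗ o) (a , b) with locate φ o a
... | W , w , plug = W , w , λ β c → plug β c , b
locate (φ ∧ ψ) (∧ᵣ o) (a , b) with locate ψ o b
... | W , w , plug = W , w , λ β c → a , plug β c
locate (φ ⊗ ψ) (⊗ₗ o) (Y , Z , Y⊆X , Z⊆X , cover , a , b) with locate φ o a
... | W , w , plug = W , w , λ β c → Y , Z , Y⊆X , Z⊆X , cover , plug β c , b
locate (φ ⊗ ψ) (⊗ᵣ o) (Y , Z , Y⊆X , Z⊆X , cover , a , b) with locate ψ o b
... | W , w , plug = W , w , λ β c → Y , Z , Y⊆X , Z⊆X , cover , a , plug β c

yes-witness : ∀ {A : Set} (a? : Dec A) → does a? ≡ true → A
yes-witness (yes a) _  = a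
yes-witness (no _)  ()

module _ (em : ExcludedMiddle 0ℓ) where

  -- Strong elimination 2: the team at the occurrence is empty or not.
  ⊨-SE2 : ∀ {φ} (o : Occ φ) {X : Team} → X ⊨ φ →
    (X ⊨ replaceAt φ o (subAt φ o ∧ ⊥)) ⊎ (X ⊨ replaceAt φ o (subAt φ o ∧ NE))
  ⊨-SE2 {φ} o h with locate φ o h
  ... | W , w , plug with em {Satisfiable W}
  ... | yes ne = inj₂ (plug _ (w , lift ne))
  ... | no ¬ne = inj₁ (plug _ (w , lift λ s x → ¬ne (s , x)))

  -- Strong elimination 1: the team at an occurrence of NE is nonempty, so its
  -- image on N is a nonempty team Y on N, and every enumeration of Y yields
  -- a Θ*_Y that can replace the occurrence.
  ⊨-SE1 : ∀ {φ} N (o : Occ φ) → subAt φ o ≡ NE → {X : Team} → X ⊨ φ →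
    Σ (Vec Bool (length N) → Bool) λ Y → (∃ λ v → Y v ≡ true) ×
      (∀ ys → (∀ v → (v ∈ ys) ⇔ (Y v ≡ true)) → X ⊨ replaceAt φ o (Θ* N ys))
  ⊨-SE1 {φ} N o at-NE {X} h with locate φ o h
  ... | W , w , plug with subst (W ⊨_) at-NE w
  ... | lift (s₀ , x₀) = Y , (restrict N s₀ , dec-true em (s₀ , x₀ , refl)) , satisfied
    where
    Y : Vec Bool (length N) → Bool
    Y v = does (em {Image N W v})
    satisfied : ∀ ys → (∀ v → (v ∈ ys) ⇔ (Y v ≡ true)) → X ⊨ replaceAt φ o (Θ* N ys)
    satisfied ys iff = plug _ (Θ*-complete N ys (s₀ , x₀)
      ( (λ s x → Equivalence.from (iff (restrict N s)) (dec-true em (s , x , refl)))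
      , (λ v v∈ → yes-witness em (Equivalence.to (iff v) v∈))))

  sound : ∀ {Γ φ} → Γ ⊢ φ → ∀ {X} → X ⊨ᵃ Γ → X ⊨ φ
  sound (assm γ)  h = h _ γ
  sound (EM i)    h = ⊨-EM i
  sound (∧I d e)  h = sound d h , sound e h
  sound (∧E₁ d)   h = proj₁ (sound d h)
  sound (∧E₂ d)   h = proj₂ (sound d h)
  sound (⊗I {ψ = ψ} c d) {X} h =
    X , ∅ , ⊆-refl , (λ s ()) , (λ s → inj₁) , sound d h , classical-empty ψ c
  sound (⊗Dup d) {X} h = X , X , ⊆-refl , ⊆-refl , (λ s → inj₁) , sound d h , sound d h
  sound (⊗E {α = α} Δ Δ⊆Γ cl cα d d₁ d₂) h with sound d h
  ... | Y , Z , Y⊆X , Z⊆X , cover , y , z =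
    classical-union α cα cover
      (sound d₁ (⊨ᵃ-extend (classical-ctx-downward Δ⊆Γ cl Y⊆X h) y))
      (sound d₂ (⊨ᵃ-extend (classical-ctx-downward Δ⊆Γ cl Z⊆X h) z))
  sound (⊗Sub Δ Δ⊆Γ cl d d₁) h with sound d h
  ... | Y , Z , Y⊆X , Z⊆X , cover , y , z =
    Y , Z , Y⊆X , Z⊆X , cover , y , sound d₁ (⊨ᵃ-extend (classical-ctx-downward Δ⊆Γ cl Z⊆X h) z)
  sound (⊗Comm d) h with sound d h
  ... | Y , Z , Y⊆X , Z⊆X , cover , y , z = Z , Y , Z⊆X , Y⊆X , (λ s x → Sum.swap (cover s x)) , z , y
  sound (⊗Ass d)  h = ⊨-⊗-assoc (sound d h)
  sound (Contr d) h with sound d h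
  ... | lift true-here , lift false-here = lift λ s x → true≢false (trans (sym (true-here s x)) (false-here s x))
    where
    true≢false : ¬ (true ≡ false)
    true≢false ()
  sound (⊗⊥E {φ = φ} d) h = ⊨-⊗⊥-elim φ (sound d h)
  sound (⊥NE-E d) h = ⊥-elim (⊥∧NE-unsat (sound d h))
  sound (⊗⊥NE d)  h with sound d h
  ... | _ , _ , _ , _ , _ , _ , z = ⊥-elim (⊥∧NE-unsat z)
  sound (ΘDist N _ xs ys _ _ different d) h with sound d h
  ... | a , b = ⊥-elim (different (Θ*-determines-team N xs ys a b))
  sound (Distr {α = α} c d) h with sound d h
  ... | a , (Y , Z , Y⊆X , Z⊆X , cover , y , z) =
    Y , Z , Y⊆X , Z⊆X , cover , (classical-downward α c Y⊆X a , y) , (classical-downward α c Z⊆X a , z)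
  sound (SE1 N _ o at-NE d k) h with ⊨-SE1 N o at-NE (sound d h)
  ... | Y , nonempty , replaced with k Y nonempty
  ... | ys , _ , enumerates , dθ = sound dθ (⊨ᵃ-extend h (replaced ys enumerates))
  sound (SE2 o d d⊥ dNE) h with ⊨-SE2 o (sound d h)
  ... | inj₁ empty-case    = sound d⊥  (⊨ᵃ-extend h empty-case)
  ... | inj₂ nonempty-case = sound dNE (⊨ᵃ-extend h nonempty-case)

theorem5p9 : ExcludedMiddle 0ℓ → (Γ : Ctx) (φ : Form) → Γ ⊢ φ → Γ ⊨ᶜ φ
theorem5p9 em Γ φ d X h = sound em d h
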